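{- Let $G$ be a finite group. The following are equivalent: (1) $\mathcal{G}_e(G)$ is bipartite; (2) $\mathcal{G}_e(G)$ is a tree; (3) $G\cong \mathbb{Z}_2\times\mathbb{Z}_2\times\cdots\times\mathbb{Z}_2$; (4) $\mathcal{G}_e(G)$ is a star graph.
   Context: For a group $G$, the enhanced power graph $\mathcal{G}_e(G)$ is the simple undirected graph with vertex set $G$ in which two distinct vertices $x,y$ are adjacent if there exists $z\in G$ with $x=z^m$ and $y=z^n$ for some $m,n\in\mathbb{N}$. -}

module Defs where

open import Data.Nat using (ℕ; zero; suc; _≥_)
open import Data.Fin using (Fin)
open import Data.Bool using (Bool; _xor_)
open import Data.Vec using (Vec; zipWith)
open import Data.List using (List; []; _∷_; length)
open import Data.List.Relation.Unary.Unique.Propositional using (Unique)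
open import Data.Product using (Σ; ∃; ∃-syntax; _×_; _,_)
open import Data.Sum using (_⊎_)
open import Relation.Nullary using (¬_)
open import Relation.Binary.PropositionalEquality using (_≡_; _≢_)
open import Algebra.Structures using (IsGroup)
open import Function.Definitions using (Bijective)
open import Function.Bundles using (_⇔_)

-- Finite groups: a group structure (with propositional equality) on Fin n.
-- Every finite group is isomorphic to one of this form.

record FiniteGroup : Set where
  field
    order   : ℕ
    _∙_     : Fin order → Fin order → Fin order
    ε       : Fin order
    _⁻¹     : Fin order → Fin order
    isGroup : IsGroup _≡_ _∙_ ε _⁻¹

  Carrier : Set
  Carrier = Fin order

  _^_ : Carrier → ℕ → Carrier
  z ^ zero  = ε
  z ^ suc m = z ∙ (z ^ m)

ConsecAdj : {V : Set} → (V → V → Set) → List V → Set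
ConsecAdj Adj []           = Data.Unit.⊤ where import Data.Unit
ConsecAdj Adj (x ∷ [])     = Data.Unit.⊤ where import Data.Unit
ConsecAdj Adj (x ∷ y ∷ vs) = Adj x y × ConsecAdj Adj (y ∷ vs)

data Walk {V : Set} (Adj : V → V → Set) : V → V → Set where
  here : ∀ {x} → Walk Adj x x
  step : ∀ {x y z} → Adj x y → Walk Adj y z → Walk Adj x z

Connected : {V : Set} → (V → V → Set) → Set
Connected Adj = ∀ x y → Walk Adj x y

IsCycle : {V : Set} → (V → V → Set) → List V → Set
IsCycle Adj []       = Data.Empty.⊥ where import Data.Empty
IsCycle Adj (v ∷ vs) =
  length (v ∷ vs) ≥ 3 × Unique (v ∷ vs) × ConsecAdj Adj (v ∷ vs ++ v ∷ [])
  where open Data.List using (_++_)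

Acyclic : {V : Set} → (V → V → Set) → Set
Acyclic Adj = ∀ cs → ¬ IsCycle Adj cs

IsTree : {V : Set} → (V → V → Set) → Set
IsTree Adj = Connected Adj × Acyclic Adj

IsBipartite : {V : Set} → (V → V → Set) → Set
IsBipartite {V} Adj = Σ (V → Bool) λ c → ∀ x y → Adj x y → c x ≢ c y

IsStar : {V : Set} → (V → V → Set) → Set
IsStar {V} Adj = Σ V λ c → ∀ x y → x ≢ y → (Adj x y ⇔ (x ≡ c ⊎ y ≡ c))

EnhancedPowerAdj : (G : FiniteGroup) → FiniteGroup.Carrier G → FiniteGroup.Carrier G → Set
EnhancedPowerAdj G x y =
  x ≢ y × Σ Carrier λ z → Σ ℕ λ m → Σ ℕ λ n → x ≡ z ^ m × y ≡ z ^ n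
  where open FiniteGroup G

-- G ≅ Z₂ × ⋯ × Z₂ (k factors), Z₂^k modelled as Vec Bool k under xor

Z2Power-op : ∀ {k} → Vec Bool k → Vec Bool k → Vec Bool k
Z2Power-op = zipWith _xor_

IsoToZ2Power : FiniteGroup → Set
IsoToZ2Power G =
  Σ ℕ λ k → Σ (Carrier → Vec Bool k) λ f →
    Bijective _≡_ _≡_ f × (∀ x y → f (x ∙ y) ≡ Z2Power-op (f x) (f y))
  where open FiniteGroup G

-- If some g has g² ≠ 1, then 1, g, g² are three distinct powers of g, hence a
-- triangle in the enhanced power graph, which is neither bipartite nor acyclic.
-- If instead every element squares to 1, every power of z is 1 or z, so each
-- edge has 1 as an endpoint: the graph is the star centred at 1, which is a
-- tree and bipartite. Finally a group of exponent two is abelian, hence an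
-- F₂-vector space; a greedily extended independent family is a basis, and
-- coordinates with respect to it give G ≅ Z₂ᵏ.
module Submission where

open import Defs
open import Data.Product using (_×_)
open import Function.Bundles using (_⇔_)

open import Level using (0ℓ)
open import Data.Nat using (ℕ; zero; suc; _+_; _≤_; z≤n; s≤s)
open import Data.Nat.Properties using (+-identityʳ; +-suc; 1+n≰n)
open import Data.Fin.Properties using (_≟_; all?; ¬∀⟶∃¬; injective⇒≤)
open import Data.Fin.Subset using (Subset; ⁅_⁆; _∈_)
open import Data.Fin.Subset.Properties using (anySubset?; x∈⁅x⁆; x∈⁅y⁆⇒x≡y)
open import Data.Bool using (Bool; true; false; not; _xor_; if_then_else_)
open import Data.Bool.Properties using (¬-not; not-involutive; xor-same)
open import Data.Vec using (Vec; []; _∷_; replicate)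
open import Data.List using ([]; _∷_; _++_)
open import Data.List.Relation.Unary.All using (All; []; _∷_)
open import Data.List.Relation.Unary.AllPairs using ([]; _∷_)
open import Data.Product using (∃; _,_; proj₁; proj₂)
open import Data.Sum using (_⊎_; inj₁; inj₂; [_,_]′)
open import Data.Unit using (tt)
open import Relation.Nullary using (¬_; Dec; yes; no; does; contradiction)
open import Relation.Nullary.Decidable using (decidable-stable)
open import Relation.Binary.Definitions using (DecidableEquality)
open import Relation.Binary.PropositionalEquality
open import Algebra.Bundles using (Group; AbelianGroup)
open import Function.Base using (_∘_)
open import Function.Definitions using (Injective)
open import Function.Bundles using (mk⇔; Equivalence)

⁅⁆-injective : ∀ {n} → Injective _≡_ _≡_ (⁅_⁆ {n})
⁅⁆-injective {x = i} {j} ⁅i⁆≡⁅j⁆ = x∈⁅y⁆⇒x≡y j (subst (i ∈_) ⁅i⁆≡⁅j⁆ (x∈⁅x⁆ i))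

Z2Power-op-self : ∀ {k} (u : Vec Bool k) → Z2Power-op u u ≡ replicate k false
Z2Power-op-self []      = refl
Z2Power-op-self (b ∷ u) = cong₂ _∷_ (xor-same b) (Z2Power-op-self u)

module _ {V : Set} {Adj : V → V → Set} where

  record Triangle : Set where
    field
      a b c    : V
      a≢b      : a ≢ b
      b≢c      : b ≢ c
      a≢c      : a ≢ c
      adj-ab   : Adj a b
      adj-bc   : Adj b c
      adj-ca   : Adj c a

  triangle⇒¬bipartite : Triangle → ¬ IsBipartite Adj
  triangle⇒¬bipartite t (colour , proper) = proper c a adj-ca colour-c≡colour-a
    where
      open Triangle t
      colour-c≡colour-a : colour c ≡ colour a
      colour-c≡colour-a = begin
        colour c             ≡⟨ ¬-not (proper b c adj-bc ∘ sym) ⟩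
        not (colour b)       ≡⟨ cong not (¬-not (proper a b adj-ab ∘ sym)) ⟩
        not (not (colour a)) ≡⟨ not-involutive (colour a) ⟩
        colour a             ∎
        where open ≡-Reasoning

  triangle⇒¬acyclic : Triangle → ¬ Acyclic Adj
  triangle⇒¬acyclic t acyclic = acyclic (a ∷ b ∷ c ∷ [])
    ( s≤s (s≤s (s≤s z≤n))
    , (a≢b ∷ a≢c ∷ []) ∷ (b≢c ∷ []) ∷ [] ∷ []
    , adj-ab , adj-bc , adj-ca , tt )
    where open Triangle t

  module _ (loopless : ∀ {x y} → Adj x y → x ≢ y) where

    star-endpoint : ((c , _) : IsStar Adj) → ∀ {x y} → Adj x y → x ≡ c ⊎ y ≡ c
    star-endpoint (c , star) xy = Equivalence.to (star _ _ (loopless xy)) xy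

    -- Both edges contain the centre, and the distinct u, b cannot both be it.
    star-middle : ((c , _) : IsStar Adj) → ∀ {u a b} → u ≢ b →
                  Adj u a → Adj a b → a ≡ c
    star-middle s u≢b ua ab with star-endpoint s ua | star-endpoint s ab
    ... | inj₂ a≡c | _        = a≡c
    ... | _        | inj₁ a≡c = a≡c
    ... | inj₁ u≡c | inj₂ b≡c = contradiction (trans u≡c (sym b≡c)) u≢b

    star⇒acyclic : IsStar Adj → Acyclic Adj
    star⇒acyclic s (v₀ ∷ v₁ ∷ v₂ ∷ vs)
                 ( _ , (_ ∷ v₀≢v₂ ∷ _) ∷ (v₁≢v₂ ∷ v₁≢vs) ∷ _ , adj₀₁ , adj₁₂ , adj₂)
      = v₁≢v₂ (trans (star-middle s v₀≢v₂ adj₀₁ adj₁₂) (sym (v₂-central vs v₁≢vs adj₂)))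
      where
        v₂-central : ∀ vs → All (v₁ ≢_) vs → ConsecAdj Adj (v₂ ∷ vs ++ v₀ ∷ []) →
                     v₂ ≡ proj₁ s
        v₂-central []      _            (adj₂₀ , _) =
          star-middle s (λ v₁≡v₀ → loopless adj₀₁ (sym v₁≡v₀)) adj₁₂ adj₂₀
        v₂-central (_ ∷ _) (v₁≢v₃ ∷ _) (adj₂₃ , _) = star-middle s v₁≢v₃ adj₁₂ adj₂₃
    star⇒acyclic s []                   ()
    star⇒acyclic s (_ ∷ [])             (s≤s () , _)
    star⇒acyclic s (_ ∷ _ ∷ [])         (s≤s (s≤s ()) , _)

    module _ (_≟ᵥ_ : DecidableEquality V) where

      star⇒connected : IsStar Adj → Connected Adj
      star⇒connected (c , star) x y = via-centre (x ≟ᵥ c)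
        where
          from-centre : Walk Adj c y
          from-centre with c ≟ᵥ y
          ... | yes refl = here
          ... | no c≢y   = step (Equivalence.from (star c y c≢y) (inj₁ refl)) here

          via-centre : Dec (x ≡ c) → Walk Adj x y
          via-centre (yes refl) = from-centre
          via-centre (no x≢c)   = step (Equivalence.from (star x c x≢c) (inj₂ refl)) from-centre

      star⇒tree : IsStar Adj → IsTree Adj
      star⇒tree s = star⇒connected s , star⇒acyclic s

      star⇒bipartite : IsStar Adj → IsBipartite Adj
      star⇒bipartite s@(c , _) = (λ v → does (v ≟ᵥ c)) , proper
        where
          proper : ∀ x y → Adj x y → does (x ≟ᵥ c) ≢ does (y ≟ᵥ c)
          proper x y xy with x ≟ᵥ c | y ≟ᵥ c
          ... | yes x≡c | yes y≡c = λ _ → loopless xy (trans x≡c (sym y≡c))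
          ... | yes _   | no _    = λ ()
          ... | no _    | yes _   = λ ()
          ... | no x≢c  | no y≢c  = λ _ → [ x≢c , y≢c ]′ (star-endpoint s xy)

HasExponentTwo : FiniteGroup → Set
HasExponentTwo G = ∀ x → x ∙ x ≡ ε
  where open FiniteGroup G

module _ (G : FiniteGroup) where
  open FiniteGroup G

  group : Group 0ℓ 0ℓ
  group = record { isGroup = isGroup }

  open Group group using (identityˡ; identityʳ)
  open import Algebra.Properties.Group group using (∙-cancelˡ; inverseˡ-unique; x≈z//y; ⁻¹-anti-homo-∙)

  enhancedPower-loopless : ∀ {x y} → EnhancedPowerAdj G x y → x ≢ y
  enhancedPower-loopless = proj₁

  powers-adjacent : ∀ g m n → g ^ m ≢ g ^ n → EnhancedPowerAdj G (g ^ m) (g ^ n)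
  powers-adjacent g m n gᵐ≢gⁿ = gᵐ≢gⁿ , g , m , n , refl , refl

  square≢ε⇒triangle : ∀ g → g ∙ g ≢ ε → Triangle {Adj = EnhancedPowerAdj G}
  square≢ε⇒triangle g g²≢ε = record
    { a = g ^ 0 ; b = g ^ 1 ; c = g ^ 2
    ; a≢b = g⁰≢g¹ ; b≢c = g¹≢g² ; a≢c = g⁰≢g²
    ; adj-ab = powers-adjacent g 0 1 g⁰≢g¹
    ; adj-bc = powers-adjacent g 1 2 g¹≢g²
    ; adj-ca = powers-adjacent g 2 0 (g⁰≢g² ∘ sym)
    }
    where
      g²≡g∙g : g ^ 2 ≡ g ∙ g
      g²≡g∙g = cong (g ∙_) (identityʳ g)

      g⁰≢g² : g ^ 0 ≢ g ^ 2
      g⁰≢g² ε≡g² = g²≢ε (trans (sym g²≡g∙g) (sym ε≡g²))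

      g⁰≢g¹ : g ^ 0 ≢ g ^ 1
      g⁰≢g¹ ε≡g∙ε = g⁰≢g² (begin
        ε             ≡⟨ ε≡g∙ε ⟩
        g ∙ ε         ≡⟨ cong (g ∙_) ε≡g∙ε ⟩
        g ∙ (g ∙ ε)   ∎)
        where open ≡-Reasoning

      g¹≢g² : g ^ 1 ≢ g ^ 2
      g¹≢g² = g⁰≢g¹ ∘ ∙-cancelˡ g _ _

  triangle-free⇒exponentTwo : ¬ Triangle {Adj = EnhancedPowerAdj G} → HasExponentTwo G
  triangle-free⇒exponentTwo no-triangle x =
    decidable-stable (x ∙ x ≟ ε) (no-triangle ∘ square≢ε⇒triangle x)

  Z2Power⇒exponentTwo : IsoToZ2Power G → HasExponentTwo G
  Z2Power⇒exponentTwo (k , f , (f-injective , _) , f-homo) x = f-injective (begin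
    f (x ∙ x)               ≡⟨ f-homo x x ⟩
    Z2Power-op (f x) (f x)  ≡⟨ Z2Power-op-self (f x) ⟩
    replicate k false       ≡⟨ Z2Power-op-self (f ε) ⟨
    Z2Power-op (f ε) (f ε)  ≡⟨ f-homo ε ε ⟨
    f (ε ∙ ε)               ≡⟨ cong f (identityˡ ε) ⟩
    f ε                     ∎)
    where open ≡-Reasoning

  module _ (sq : HasExponentTwo G) where

    self-inverse : ∀ x → x ⁻¹ ≡ x
    self-inverse x = sym (inverseˡ-unique x x (sq x))

    comm : ∀ x y → x ∙ y ≡ y ∙ x
    comm x y = begin
      x ∙ y              ≡⟨ self-inverse (x ∙ y) ⟨
      (x ∙ y) ⁻¹         ≡⟨ ⁻¹-anti-homo-∙ x y ⟩
      (y ⁻¹) ∙ (x ⁻¹)    ≡⟨ cong₂ _∙_ (self-inverse y) (self-inverse x) ⟩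
      y ∙ x              ∎
      where open ≡-Reasoning

    abelianGroup : AbelianGroup 0ℓ 0ℓ
    abelianGroup = record { isAbelianGroup = record { isGroup = isGroup ; comm = comm } }

    open import Algebra.Properties.CommutativeSemigroup
      (AbelianGroup.commutativeSemigroup abelianGroup) using (interchange)

    ^-trivial : ∀ z m → z ^ m ≡ ε ⊎ z ^ m ≡ z
    ^-trivial z zero    = inj₁ refl
    ^-trivial z (suc m) with ^-trivial z m
    ... | inj₁ zᵐ≡ε = inj₂ (trans (cong (z ∙_) zᵐ≡ε) (identityʳ z))
    ... | inj₂ zᵐ≡z = inj₁ (trans (cong (z ∙_) zᵐ≡z) (sq z))

    exponentTwo⇒star : IsStar (EnhancedPowerAdj G)
    exponentTwo⇒star = ε , λ x y x≢y → mk⇔ (edge-meets-ε x≢y) (meets-ε⇒edge x≢y)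
      where
        edge-meets-ε : ∀ {x y} → x ≢ y → EnhancedPowerAdj G x y → x ≡ ε ⊎ y ≡ ε
        edge-meets-ε x≢y (_ , z , m , n , refl , refl) with ^-trivial z m | ^-trivial z n
        ... | inj₁ zᵐ≡ε | _         = inj₁ zᵐ≡ε
        ... | inj₂ _    | inj₁ zⁿ≡ε = inj₂ zⁿ≡ε
        ... | inj₂ zᵐ≡z | inj₂ zⁿ≡z = contradiction (trans zᵐ≡z (sym zⁿ≡z)) x≢y

        meets-ε⇒edge : ∀ {x y} → x ≢ y → x ≡ ε ⊎ y ≡ ε → EnhancedPowerAdj G x y
        meets-ε⇒edge {y = y} x≢y (inj₁ refl) = x≢y , y , 0 , 1 , refl , sym (identityʳ y)
        meets-ε⇒edge {x = x} x≢y (inj₂ refl) = x≢y , x , 1 , 0 , sym (identityʳ x) , refl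

    combination : ∀ {k} → Vec Carrier k → Subset k → Carrier
    combination []       []      = ε
    combination (g ∷ gs) (b ∷ u) = (if b then g else ε) ∙ combination gs u

    combination-homo : ∀ {k} (gs : Vec Carrier k) u v →
      combination gs (Z2Power-op u v) ≡ combination gs u ∙ combination gs v
    combination-homo []       []      []      = sym (identityˡ ε)
    combination-homo (g ∷ gs) (b ∷ u) (c ∷ v) =
      trans (cong₂ _∙_ (if-xor b c) (combination-homo gs u v)) (interchange _ _ _ _)
      where
        if-xor : ∀ b c → (if b xor c then g else ε) ≡ (if b then g else ε) ∙ (if c then g else ε)
        if-xor false false = sym (identityˡ ε)
        if-xor false true  = sym (identityˡ g)
        if-xor true  false = sym (identityʳ g)
        if-xor true  true  = sym (sq g)

    _∈⟨_⟩ : ∀ {k} → Carrier → Vec Carrier k → Set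
    x ∈⟨ gs ⟩ = ∃ λ u → combination gs u ≡ x

    _∈⟨_⟩? : ∀ {k} x (gs : Vec Carrier k) → Dec (x ∈⟨ gs ⟩)
    x ∈⟨ gs ⟩? = anySubset? (λ u → combination gs u ≟ x)

    Independent : ∀ {k} → Vec Carrier k → Set
    Independent gs = Injective _≡_ _≡_ (combination gs)

    Spanning : ∀ {k} → Vec Carrier k → Set
    Spanning gs = ∀ x → x ∈⟨ gs ⟩

    ∙combination≡combination⇒∈⟨⟩ : ∀ {k} (gs : Vec Carrier k) {h} u v →
      h ∙ combination gs u ≡ combination gs v → h ∈⟨ gs ⟩
    ∙combination≡combination⇒∈⟨⟩ gs {h} u v eq = Z2Power-op v u , (begin
      combination gs (Z2Power-op v u)          ≡⟨ combination-homo gs v u ⟩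
      combination gs v ∙ combination gs u      ≡⟨ cong (combination gs v ∙_) (self-inverse _) ⟨
      combination gs v ∙ (combination gs u ⁻¹) ≡⟨ x≈z//y h _ _ eq ⟨
      h                                        ∎)
      where open ≡-Reasoning

    independent-∷ : ∀ {k} {gs : Vec Carrier k} {h} → Independent gs → ¬ h ∈⟨ gs ⟩ →
                    Independent (h ∷ gs)
    independent-∷ indep h∉ {false ∷ u} {false ∷ v} eq =
      cong (false ∷_) (indep (∙-cancelˡ ε _ _ eq))
    independent-∷ indep h∉ {true  ∷ u} {true  ∷ v} eq =
      cong (true ∷_) (indep (∙-cancelˡ _ _ _ eq))
    independent-∷ {gs = gs} indep h∉ {true  ∷ u} {false ∷ v} eq =
      contradiction (∙combination≡combination⇒∈⟨⟩ gs u v (trans eq (identityˡ _))) h∉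
    independent-∷ {gs = gs} indep h∉ {false ∷ u} {true  ∷ v} eq =
      contradiction (∙combination≡combination⇒∈⟨⟩ gs v u (trans (sym eq) (identityˡ _))) h∉

    independent⇒≤order : ∀ {k} {gs : Vec Carrier k} → Independent gs → k ≤ order
    independent⇒≤order indep = injective⇒≤ (⁅⁆-injective ∘ indep)

    record Basis : Set where
      field
        dim         : ℕ
        vectors     : Vec Carrier dim
        independent : Independent vectors
        spanning    : Spanning vectors

    -- Independent families have at most order members, so fuel bounds the
    -- number of extensions still possible.
    extend-to-basis : ∀ fuel {k} (gs : Vec Carrier k) → Independent gs →
                      k + fuel ≡ suc order → Basis
    extend-to-basis zero {k} gs indep k+0≡1+order =
      contradiction (subst (_≤ order) k≡1+order (independent⇒≤order {gs = gs} indep)) 1+n≰n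
      where
        k≡1+order : k ≡ suc order
        k≡1+order = trans (sym (+-identityʳ k)) k+0≡1+order
    extend-to-basis (suc fuel) {k} gs indep k+1+fuel≡1+order with all? (_∈⟨ gs ⟩?)
    ... | yes spanning = record { vectors = gs ; independent = indep ; spanning = spanning }
    ... | no ¬spanning with h , h∉ ← ¬∀⟶∃¬ order _ (_∈⟨ gs ⟩?) ¬spanning =
      extend-to-basis fuel (h ∷ gs) (independent-∷ indep h∉)
                      (trans (sym (+-suc k fuel)) k+1+fuel≡1+order)

    basis : Basis
    basis = extend-to-basis (suc order) [] (λ { {[]} {[]} _ → refl }) refl

    basis⇒Z2Power : Basis → IsoToZ2Power G
    basis⇒Z2Power b =
      dim , coordinates , (coordinates-injective , coordinates-surjective) , coordinates-homo
      where
        open Basis b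

        coordinates : Carrier → Subset dim
        coordinates x = proj₁ (spanning x)

        combination-coordinates : ∀ x → combination vectors (coordinates x) ≡ x
        combination-coordinates x = proj₂ (spanning x)

        coordinates-injective : Injective _≡_ _≡_ coordinates
        coordinates-injective {x} {y} eq = begin
          x                                      ≡⟨ combination-coordinates x ⟨
          combination vectors (coordinates x)    ≡⟨ cong (combination vectors) eq ⟩
          combination vectors (coordinates y)    ≡⟨ combination-coordinates y ⟩
          y                                      ∎
          where open ≡-Reasoning

        coordinates-surjective : ∀ u → ∃ λ x → ∀ {z} → z ≡ x → coordinates z ≡ u
        coordinates-surjective u = combination vectors u ,
          λ { refl → independent (combination-coordinates (combination vectors u)) }

        coordinates-homo : ∀ x y → coordinates (x ∙ y) ≡ Z2Power-op (coordinates x) (coordinates y)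
        coordinates-homo x y = independent (begin
          combination vectors (coordinates (x ∙ y))
            ≡⟨ combination-coordinates (x ∙ y) ⟩
          x ∙ y
            ≡⟨ cong₂ _∙_ (combination-coordinates x) (combination-coordinates y) ⟨
          combination vectors (coordinates x) ∙ combination vectors (coordinates y)
            ≡⟨ combination-homo vectors _ _ ⟨
          combination vectors (Z2Power-op (coordinates x) (coordinates y))
            ∎)
          where open ≡-Reasoning

    exponentTwo⇒Z2Power : IsoToZ2Power G
    exponentTwo⇒Z2Power = basis⇒Z2Power basis

  bipartite⇒exponentTwo : IsBipartite (EnhancedPowerAdj G) → HasExponentTwo G
  bipartite⇒exponentTwo bipartite =
    triangle-free⇒exponentTwo (λ t → triangle⇒¬bipartite t bipartite)

  tree⇒exponentTwo : IsTree (EnhancedPowerAdj G) → HasExponentTwo G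
  tree⇒exponentTwo (_ , acyclic) =
    triangle-free⇒exponentTwo (λ t → triangle⇒¬acyclic t acyclic)

  star⇒exponentTwo : IsStar (EnhancedPowerAdj G) → HasExponentTwo G
  star⇒exponentTwo = bipartite⇒exponentTwo ∘ star⇒bipartite enhancedPower-loopless _≟_

  exponentTwo⇒tree : HasExponentTwo G → IsTree (EnhancedPowerAdj G)
  exponentTwo⇒tree = star⇒tree enhancedPower-loopless _≟_ ∘ exponentTwo⇒star

  exponentTwo⇒bipartite : HasExponentTwo G → IsBipartite (EnhancedPowerAdj G)
  exponentTwo⇒bipartite = star⇒bipartite enhancedPower-loopless _≟_ ∘ exponentTwo⇒star

corollary2p3 : (G : FiniteGroup) →
    (IsBipartite (EnhancedPowerAdj G) ⇔ IsTree (EnhancedPowerAdj G))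
    × (IsTree (EnhancedPowerAdj G) ⇔ IsoToZ2Power G)
    × (IsoToZ2Power G ⇔ IsStar (EnhancedPowerAdj G))
corollary2p3 G =
    mk⇔ (exponentTwo⇒tree G ∘ bipartite⇒exponentTwo G)
        (exponentTwo⇒bipartite G ∘ tree⇒exponentTwo G)
  , mk⇔ (exponentTwo⇒Z2Power G ∘ tree⇒exponentTwo G)
        (exponentTwo⇒tree G ∘ Z2Power⇒exponentTwo G)
  , mk⇔ (exponentTwo⇒star G ∘ Z2Power⇒exponentTwo G)
        (exponentTwo⇒Z2Power G ∘ star⇒exponentTwo G)
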